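{- For any finite linearly ordered set $S$, the map $\mathcal{P}(S)\to\mathcal{P}(S)$ sending each subset $A\subseteq S$ to its complement $S\setminus A$ is a lattice antiautomorphism of $\mathcal{P}(S)$.
   Context: $\mathcal{P}(S)$ is the set of all subsets of $S$, ordered by: for $A=\{a_1<\dots<a_k\}$ and $B=\{b_1<\dots<b_m\}$, $A\le B$ iff $m\le k$ and $a_i\le b_i$ for $1\le i\le m$. With this order $\mathcal{P}(S)$ is a distributive lattice. -}

module Defs where

open import Data.Nat using (ℕ; zero; suc)
open import Data.Bool using (true; false)
open import Data.Vec using ([]; _∷_)
open import Data.List using (List; []; _∷_; map)
open import Data.Fin using (Fin; zero; suc; _≤_)
open import Data.Fin.Subset using (Subset; ∁)
open import Data.Unit using (⊤)
open import Data.Empty using (⊥)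
open import Data.Product using (_×_)
open import Relation.Binary.PropositionalEquality using (_≡_)
open import Function.Definitions using (Bijective)
open import Function.Bundles using (_⇔_)

-- A finite linearly ordered set S with |S| = n is (uniquely) isomorphic to Fin n
-- with its usual order; subsets of S are  Subset n  (characteristic vectors).

elems : {n : ℕ} → Subset n → List (Fin n)
elems []          = []
elems (true  ∷ p) = zero ∷ map suc (elems p)
elems (false ∷ p) = map suc (elems p)

_≼_ : {n : ℕ} → List (Fin n) → List (Fin n) → Set
as       ≼ []       = ⊤
[]       ≼ (b ∷ bs) = ⊥
(a ∷ as) ≼ (b ∷ bs) = (a ≤ b) × (as ≼ bs)

_⊑_ : {n : ℕ} → Subset n → Subset n → Set
A ⊑ B = elems A ≼ elems B

IsMeet : {n : ℕ} → Subset n → Subset n → Subset n → Set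
IsMeet {n} A B M = (M ⊑ A) × (M ⊑ B) × ((X : Subset n) → X ⊑ A → X ⊑ B → X ⊑ M)

IsJoin : {n : ℕ} → Subset n → Subset n → Subset n → Set
IsJoin {n} A B J = (A ⊑ J) × (B ⊑ J) × ((X : Subset n) → A ⊑ X → B ⊑ X → J ⊑ X)

IsLatticeAntiautomorphism : {n : ℕ} → (Subset n → Subset n) → Set
IsLatticeAntiautomorphism {n} f =
  Bijective _≡_ _≡_ f
  × ((A B : Subset n) → (A ⊑ B) ⇔ (f B ⊑ f A))
  × ((A B M : Subset n) → IsMeet A B M → IsJoin (f A) (f B) (f M))
  × ((A B J : Subset n) → IsJoin A B J → IsMeet (f A) (f B) (f J))

-- Scanning {0, …, n-1} from left to right, keep track of the surplus of members of A
-- over members of B.  Then A ⊑ B says exactly that this surplus never becomes negative,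
-- i.e. every initial segment contains at least as many members of A as of B.
-- Complementing both sets and exchanging them leaves every surplus unchanged, so ∁
-- reverses ⊑; being an involution, it then exchanges meets and joins.
module Submission where

open import Defs
open import Data.Nat using (ℕ)
open import Data.Fin.Subset using (∁)

open import Algebra.Definitions using (Involutive)
open import Data.Bool using (true; false)
open import Data.Bool.Properties using (not-involutive)
open import Data.Empty using (⊥)
open import Data.Fin using (Fin; zero; suc)
open import Data.Fin.Subset using (Subset)
open import Data.List using (List; []; _∷_; map; drop)
open import Data.Nat using (zero; suc; z≤n; s≤s; s≤s⁻¹)
open import Data.Product using (_,_; proj₂)
open import Data.Product.Function.NonDependent.Propositional using (_×-⇔_)
open import Data.Unit using (⊤)
open import Data.Vec using ([]; _∷_)
open import Function.Base using (id; _∘_)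
open import Function.Bundles using (_⇔_; mk⇔; Equivalence)
open import Function.Consequences.Propositional
  using (inverseᵇ⇒bijective; strictlyInverseˡ⇒inverseˡ; strictlyInverseʳ⇒inverseʳ)
open import Function.Construct.Composition using (_⇔-∘_)
open import Function.Construct.Identity using (⇔-id)
open import Relation.Binary.PropositionalEquality using (_≡_; refl; cong₂; subst; subst₂)

private
  variable
    n : ℕ

-- xs ≼ drop d ys says that xs, preceded by d copies of a least element, is ≼ ys.
map-suc-≼-drop : ∀ d (xs ys : List (Fin n)) →
                 (map suc xs ≼ drop d (map suc ys)) ⇔ (xs ≼ drop d ys)
map-suc-≼-drop (suc d) xs []       = ⇔-id ⊤
map-suc-≼-drop (suc d) xs (y ∷ ys) = map-suc-≼-drop d xs ys
map-suc-≼-drop zero    []       []       = ⇔-id ⊤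
map-suc-≼-drop zero    (x ∷ xs) []       = ⇔-id ⊤
map-suc-≼-drop zero    []       (y ∷ ys) = ⇔-id ⊥
map-suc-≼-drop zero    (x ∷ xs) (y ∷ ys) = mk⇔ s≤s⁻¹ s≤s ×-⇔ map-suc-≼-drop zero xs ys

zero∷-≼-drop : ∀ d (xs ys : List (Fin (suc n))) →
               ((zero ∷ xs) ≼ drop d ys) ⇔ (xs ≼ drop (suc d) ys)
zero∷-≼-drop zero    xs []       = ⇔-id ⊤
zero∷-≼-drop zero    xs (y ∷ ys) = mk⇔ proj₂ (z≤n ,_)
zero∷-≼-drop (suc d) xs []       = ⇔-id ⊤
zero∷-≼-drop (suc d) xs (y ∷ ys) = zero∷-≼-drop d xs ys

map-suc-⋠-zero∷ : (xs : List (Fin n)) (ys : List (Fin (suc n))) → map suc xs ≼ (zero ∷ ys) → ⊥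
map-suc-⋠-zero∷ (x ∷ xs) ys (() , _)

Dominates : ℕ → Subset n → Subset n → Set
Dominates d       []          []          = ⊤
Dominates d       (true  ∷ A) (true  ∷ B) = Dominates d A B
Dominates d       (false ∷ A) (false ∷ B) = Dominates d A B
Dominates d       (true  ∷ A) (false ∷ B) = Dominates (suc d) A B
Dominates zero    (false ∷ A) (true  ∷ B) = ⊥
Dominates (suc d) (false ∷ A) (true  ∷ B) = Dominates d A B

≼-drop⇔Dominates : ∀ d (A B : Subset n) → (elems A ≼ drop d (elems B)) ⇔ Dominates d A B
≼-drop⇔Dominates zero    []          []          = ⇔-id ⊤
≼-drop⇔Dominates (suc d) []          []          = ⇔-id ⊤
≼-drop⇔Dominates d       (true  ∷ A) (true  ∷ B) =
  ≼-drop⇔Dominates d A B ⇔-∘ (map-suc-≼-drop d (elems A) (elems B)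
    ⇔-∘ zero∷-≼-drop d (map suc (elems A)) (zero ∷ map suc (elems B)))
≼-drop⇔Dominates d       (false ∷ A) (false ∷ B) =
  ≼-drop⇔Dominates d A B ⇔-∘ map-suc-≼-drop d (elems A) (elems B)
≼-drop⇔Dominates d       (true  ∷ A) (false ∷ B) =
  ≼-drop⇔Dominates (suc d) A B ⇔-∘ (map-suc-≼-drop (suc d) (elems A) (elems B)
    ⇔-∘ zero∷-≼-drop d (map suc (elems A)) (map suc (elems B)))
≼-drop⇔Dominates zero    (false ∷ A) (true  ∷ B) =
  mk⇔ (map-suc-⋠-zero∷ (elems A) (map suc (elems B))) (λ ())
≼-drop⇔Dominates (suc d) (false ∷ A) (true  ∷ B) =
  ≼-drop⇔Dominates d A B ⇔-∘ map-suc-≼-drop d (elems A) (elems B)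

Dominates-∁ : ∀ d (A B : Subset n) → Dominates d A B → Dominates d (∁ B) (∁ A)
Dominates-∁ d       []          []          = id
Dominates-∁ d       (true  ∷ A) (true  ∷ B) = Dominates-∁ d A B
Dominates-∁ d       (false ∷ A) (false ∷ B) = Dominates-∁ d A B
Dominates-∁ d       (true  ∷ A) (false ∷ B) = Dominates-∁ (suc d) A B
Dominates-∁ zero    (false ∷ A) (true  ∷ B) = id
Dominates-∁ (suc d) (false ∷ A) (true  ∷ B) = Dominates-∁ d A B

∁-antitone : (A B : Subset n) → A ⊑ B → ∁ B ⊑ ∁ A
∁-antitone A B =
  from (≼-drop⇔Dominates 0 (∁ B) (∁ A)) ∘ Dominates-∁ 0 A B ∘ to (≼-drop⇔Dominates 0 A B)
  where open Equivalence

∁-involutive : Involutive {A = Subset n} _≡_ ∁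
∁-involutive []      = refl
∁-involutive (x ∷ A) = cong₂ _∷_ (not-involutive x) (∁-involutive A)

module _ {f : Subset n → Subset n} (f-involutive : Involutive _≡_ f)
         (f-antitone : (A B : Subset n) → A ⊑ B → f B ⊑ f A) where

  antitone⁻¹ : (A B : Subset n) → f B ⊑ f A → A ⊑ B
  antitone⁻¹ A B = subst₂ _⊑_ (f-involutive A) (f-involutive B) ∘ f-antitone (f B) (f A)

  antitone-swapˡ : {A X : Subset n} → f A ⊑ X → f X ⊑ A
  antitone-swapˡ {A} {X} = subst (f X ⊑_) (f-involutive A) ∘ f-antitone (f A) X

  antitone-swapʳ : {A X : Subset n} → X ⊑ f A → A ⊑ f X
  antitone-swapʳ {A} {X} = subst (_⊑ f X) (f-involutive A) ∘ f-antitone X (f A)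

  meet⇒join : (A B M : Subset n) → IsMeet A B M → IsJoin (f A) (f B) (f M)
  meet⇒join A B M (M⊑A , M⊑B , M-greatest) =
    f-antitone M A M⊑A , f-antitone M B M⊑B ,
    λ X fA⊑X fB⊑X →
      antitone-swapˡ (M-greatest (f X) (antitone-swapˡ fA⊑X) (antitone-swapˡ fB⊑X))

  join⇒meet : (A B J : Subset n) → IsJoin A B J → IsMeet (f A) (f B) (f J)
  join⇒meet A B J (A⊑J , B⊑J , J-least) =
    f-antitone A J A⊑J , f-antitone B J B⊑J ,
    λ X X⊑fA X⊑fB →
      antitone-swapʳ (J-least (f X) (antitone-swapʳ X⊑fA) (antitone-swapʳ X⊑fB))

  involution-antitone⇒antiautomorphism : IsLatticeAntiautomorphism f
  involution-antitone⇒antiautomorphism =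
    inverseᵇ⇒bijective
      (strictlyInverseˡ⇒inverseˡ f f-involutive , strictlyInverseʳ⇒inverseʳ f f-involutive) ,
    (λ A B → mk⇔ (f-antitone A B) (antitone⁻¹ A B)) , meet⇒join , join⇒meet

lemma4p1 : (n : ℕ) → IsLatticeAntiautomorphism {n} ∁
lemma4p1 n = involution-antitone⇒antiautomorphism ∁-involutive ∁-antitone
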